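{- The intersection of two benzenoids is the disjoint union of finitely many (possibly zero) benzenoids; that is, each connected component of the intersection is a benzenoid.
   Context: $\mathcal{H}$ is the set of hexagons of the regular hexagonal tiling of the plane; hexagons are adjacent if distinct and sharing an edge; the connected components of a set of hexagons are the classes of the relation "joined by a sequence of hexagons of the set, consecutive ones adjacent", and the set is connected if it has exactly one component. A benzenoid is a finite connected subset $\mathcal{B}\subseteq\mathcal{H}$ whose complement $\mathcal{H}\setminus\mathcal{B}$ is also connected. -}

module Defs where

open import Data.Integer using (ℤ; +_; -[1+_]; _-_)
open import Data.Product using (_×_; _,_; ∃; Σ)
open import Data.Bool using (Bool; true; false; not; _∧_)
open import Data.List using (List; []; _∷_)
open import Data.List.Membership.Propositional using (_∈_)
open import Relation.Binary.PropositionalEquality using (_≡_)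

-- Hexagons of the regular hexagonal tiling, in axial coordinates.
Hex : Set
Hex = ℤ × ℤ

directions : List Hex
directions = (+ 1 , + 0) ∷ (-[1+ 0 ] , + 0) ∷ (+ 0 , + 1) ∷ (+ 0 , -[1+ 0 ])
           ∷ (+ 1 , -[1+ 0 ]) ∷ (-[1+ 0 ] , + 1) ∷ []

-- Two hexagons are adjacent iff they are distinct and share an edge.
Adj : Hex → Hex → Set
Adj (a , b) (c , d) = (c - a , d - b) ∈ directions

HexSet : Set
HexSet = Hex → Bool

_∈ₕ_ : Hex → HexSet → Set
x ∈ₕ S = S x ≡ true

_∩ₕ_ : HexSet → HexSet → HexSet
(S ∩ₕ T) x = S x ∧ T x

∁ₕ : HexSet → HexSet
∁ₕ S x = not (S x)

data Walk (S : HexSet) : Hex → Hex → Set where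
  here : ∀ {x} → x ∈ₕ S → Walk S x x
  step : ∀ {x y z} → x ∈ₕ S → Adj x y → Walk S y z → Walk S x z

Joined : HexSet → Hex → Hex → Set
Joined S x y = Walk S x y

Connected : HexSet → Set
Connected S = (∃ λ x → x ∈ₕ S) × (∀ x y → x ∈ₕ S → y ∈ₕ S → Joined S x y)

FiniteSet : HexSet → Set
FiniteSet S = ∃ λ (xs : List Hex) → ∀ x → x ∈ₕ S → x ∈ xs

IsBenzenoid : HexSet → Set
IsBenzenoid B = FiniteSet B × Connected B × Connected (∁ₕ B)

-- Let C be the component of B₁ ∩ B₂ containing h, and o a hexagon outside B₁ ∪ B₂.
-- A hexagon x ∉ C reaches o in the complement of C: if x ∉ B₁ (or x ∉ B₂) use the
-- connectedness of ∁B₁ (resp. ∁B₂), which avoids C. Otherwise follow a path in B₁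
-- from x towards h ∈ C; as long as the path stays in B₂ it also stays outside C
-- (a neighbour of C in B₁ ∩ B₂ lies in C), so it either leaves B₂, and we conclude as
-- before, or it would enter C from outside, which is impossible.
-- The component itself is computed by breadth-first search, which stabilises after
-- at most |B₁| + 1 rounds.
module Submission where

open import Defs
open import Data.Bool using (true; false; T; not; _∧_; _∨_)
open import Data.Bool.Properties using (T-≡; ∧-conicalˡ; ∧-conicalʳ; ∨-zeroʳ)
open import Data.Empty using (⊥-elim)
open import Data.Integer using (+_; -_; _-_; ∣_∣)
open import Data.Integer.Properties using (_≟_)
open import Data.Integer.Tactic.RingSolver using (solve-∀)
open import Data.List using (List; []; _∷_; _++_; length; map)
open import Data.Bool.ListAction using (or; any)
open import Data.List.Membership.Propositional using (_∈_; _∉_; find; lose)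
open import Data.List.Membership.Propositional.Properties using (∈-map⁺; ∈-++⁺ˡ; ∈-++⁺ʳ)
open import Data.List.Properties using (map-cong)
open import Data.List.Relation.Unary.All as All using ()
open import Data.List.Relation.Unary.Any using (here; there)
open import Data.List.Relation.Unary.Any.Properties using (any⁺; any⁻)
open import Data.Nat using (ℕ; zero; suc; _≤_; _<_; z≤n; s≤s)
open import Data.Nat.Properties using (≤-totalOrder; m≤n⇒m≤1+n; ≤-trans; <-irrefl)
open import Data.List.Extrema ≤-totalOrder using (max; xs≤max)
open import Data.Product using (_×_; _,_; ∃; proj₁; proj₂)
open import Data.Product.Properties using (≡-dec)
open import Data.Sum using (_⊎_; inj₁; inj₂; [_,_]′)
open import Function using (id; _∘_)
open import Function.Bundles using (_⇔_; mk⇔; Equivalence)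
open import Relation.Nullary using (Dec; yes; no; ¬_)
open import Relation.Nullary.Decidable using (⌊_⌋)
open import Relation.Binary.PropositionalEquality

_≟ₕ_ : (x y : Hex) → Dec (x ≡ y)
_≟ₕ_ = ≡-dec _≟_ _≟_

infixl 21 _-ₕ_

_-ₕ_ : Hex → Hex → Hex
(a , b) -ₕ (c , d) = a - c , b - d

m-[m-n]≡n : ∀ m n → m - (m - n) ≡ n
m-[m-n]≡n = solve-∀

m-n≡-[n-m] : ∀ m n → m - n ≡ - (n - m)
m-n≡-[n-m] = solve-∀

directions-neg : ∀ {a b} → (a , b) ∈ directions → (- a , - b) ∈ directions
directions-neg (here refl)                                 = there (here refl)
directions-neg (there (here refl))                         = here refl
directions-neg (there (there (here refl)))                 = there (there (there (here refl)))
directions-neg (there (there (there (here refl))))         = there (there (here refl))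
directions-neg (there (there (there (there (here refl))))) =
  there (there (there (there (there (here refl)))))
directions-neg (there (there (there (there (there (here refl)))))) =
  there (there (there (there (here refl))))

Adj-sym : ∀ {x y} → Adj x y → Adj y x
Adj-sym {a , b} {c , d} x~y
  rewrite m-n≡-[n-m] a c | m-n≡-[n-m] b d = directions-neg x~y

Adj-sub : ∀ x {d} → d ∈ directions → Adj (x -ₕ d) x
Adj-sub (a , b) {d₁ , d₂} =
  subst (_∈ directions) (sym (cong₂ _,_ (m-[m-n]≡n a d₁) (m-[m-n]≡n b d₂)))

sub-sub-Adj : ∀ {x y} → Adj y x → x -ₕ (x -ₕ y) ≡ y
sub-sub-Adj {a , b} {c , d} _ = cong₂ _,_ (m-[m-n]≡n a c) (m-[m-n]≡n b d)

_⊆ₕ_ : HexSet → HexSet → Set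
S ⊆ₕ T = ∀ {x} → x ∈ₕ S → x ∈ₕ T

∩-⊆ˡ : ∀ {S T} → (S ∩ₕ T) ⊆ₕ S
∩-⊆ˡ {S} {x = x} = ∧-conicalˡ (S x) _

∩-⊆ʳ : ∀ {S T} → (S ∩ₕ T) ⊆ₕ T
∩-⊆ʳ {S} {x = x} = ∧-conicalʳ (S x) _

∈-∩ : ∀ {S T x} → x ∈ₕ S → x ∈ₕ T → x ∈ₕ (S ∩ₕ T)
∈-∩ = cong₂ _∧_

∉⇒∈∁ : ∀ {S x} → S x ≡ false → x ∈ₕ ∁ₕ S
∉⇒∈∁ = cong not

∈∁⇒∉ : ∀ {S x} → x ∈ₕ ∁ₕ S → ¬ x ∈ₕ S
∈∁⇒∉ x∈∁S x∈S with () ← trans (sym x∈∁S) (cong not x∈S)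

∁-anti : ∀ {S T} → S ⊆ₕ T → ∁ₕ T ⊆ₕ ∁ₕ S
∁-anti {S} {T} S⊆T {x} x∈∁T with S x in e
... | true  = ⊥-elim (∈∁⇒∉ {T} x∈∁T (S⊆T e))
... | false = refl

FiniteSet-⊆ : ∀ {S T} → S ⊆ₕ T → FiniteSet T → FiniteSet S
FiniteSet-⊆ S⊆T (xs , covers) = xs , λ x x∈S → covers x (S⊆T x∈S)

FiniteSet-∉ : ∀ {S x} (fin : FiniteSet S) → x ∉ proj₁ fin → x ∈ₕ ∁ₕ S
FiniteSet-∉ {S} {x} (_ , covers) x∉xs with S x in e
... | true  = ⊥-elim (x∉xs (covers x e))
... | false = refl

fresh : (xs : List Hex) → ∃ λ o → o ∉ xs
fresh xs = o , λ o∈xs → <-irrefl refl (All.lookup (xs≤max 0 bounds) (∈-map⁺ first o∈xs))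
  where
  first : Hex → ℕ
  first (a , _) = ∣ a ∣
  bounds : List ℕ
  bounds = map first xs
  o : Hex
  o = + suc (max 0 bounds) , + 0

Walk-start : ∀ {S x y} → Walk S x y → x ∈ₕ S
Walk-start (here x∈S)     = x∈S
Walk-start (step x∈S _ _) = x∈S

Walk-end : ∀ {S x y} → Walk S x y → y ∈ₕ S
Walk-end (here y∈S)   = y∈S
Walk-end (step _ _ w) = Walk-end w

_++ʷ_ : ∀ {S x y z} → Walk S x y → Walk S y z → Walk S x z
here _          ++ʷ w′ = w′
step x∈S x~y w ++ʷ w′ = step x∈S x~y (w ++ʷ w′)

Walk-reverse : ∀ {S x y} → Walk S x y → Walk S y x
Walk-reverse (here x∈S)       = here x∈S
Walk-reverse (step {x} {y} x∈S x~y w) =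
  Walk-reverse w ++ʷ step (Walk-start w) (Adj-sym {x} {y} x~y) (here x∈S)

Walk-mono : ∀ {S T x y} → S ⊆ₕ T → Walk S x y → Walk T x y
Walk-mono S⊆T (here x∈S)       = here (S⊆T x∈S)
Walk-mono S⊆T (step x∈S x~y w) = step (S⊆T x∈S) x~y (Walk-mono S⊆T w)

ClosedIn : HexSet → HexSet → Set
ClosedIn C S = ∀ {x y} → x ∈ₕ C → Adj x y → y ∈ₕ S → y ∈ₕ C

Walk-closed : ∀ {C S x y} → ClosedIn C S → x ∈ₕ C → Walk S x y → Walk C x y
Walk-closed closed x∈C (here _)       = here x∈C
Walk-closed closed x∈C (step _ x~y w) =
  step x∈C x~y (Walk-closed closed (closed x∈C x~y (Walk-start w)) w)

connected-towards : ∀ {S o} → o ∈ₕ S → (∀ {x} → x ∈ₕ S → Walk S x o) → Connected S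
connected-towards o∈S walk = (_ , o∈S) , λ x y x∈S y∈S → walk x∈S ++ʷ Walk-reverse (walk y∈S)

adjacentTo : HexSet → HexSet
adjacentTo S x = any (λ d → S (x -ₕ d)) directions

adjacentTo-sound : ∀ {S x} → x ∈ₕ adjacentTo S → ∃ λ y → y ∈ₕ S × Adj y x
adjacentTo-sound {S} {x} x∈ = witness (find (any⁻ _ directions (Equivalence.from T-≡ x∈)))
  where
  witness : (∃ λ d → d ∈ directions × T (S (x -ₕ d))) → ∃ λ y → y ∈ₕ S × Adj y x
  witness (d , d∈ , Sd) = x -ₕ d , Equivalence.to T-≡ Sd , Adj-sub x d∈

adjacentTo-complete : ∀ {S x y} → y ∈ₕ S → Adj y x → x ∈ₕ adjacentTo S
adjacentTo-complete {S} {x} {y} y∈S y~x =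
  Equivalence.to T-≡ (any⁺ (λ d → S (x -ₕ d)) (lose y~x (Equivalence.from T-≡ S[x-[x-y]])))
  where
  S[x-[x-y]] : (x -ₕ (x -ₕ y)) ∈ₕ S
  S[x-[x-y]] = subst (_∈ₕ S) (sym (sub-sub-Adj {x} {y} y~x)) y∈S

adjacentTo-cong : ∀ {S T} → (∀ x → S x ≡ T x) → ∀ x → adjacentTo S x ≡ adjacentTo T x
adjacentTo-cong S≗T x = cong or (map-cong (λ d → S≗T (x -ₕ d)) directions)

count : HexSet → List Hex → ℕ
count S []       = 0
count S (x ∷ xs) with S x
... | true  = suc (count S xs)
... | false = count S xs

count≤length : ∀ S xs → count S xs ≤ length xs
count≤length S []       = z≤n
count≤length S (x ∷ xs) with S x
... | true  = s≤s (count≤length S xs)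
... | false = m≤n⇒m≤1+n (count≤length S xs)

count-mono : ∀ {S T} → S ⊆ₕ T → ∀ xs → count S xs ≤ count T xs
count-mono S⊆T [] = z≤n
count-mono {S} {T} S⊆T (x ∷ xs) with S x in eS | T x in eT
... | true  | true  = s≤s (count-mono S⊆T xs)
... | true  | false with () ← trans (sym (S⊆T eS)) eT
... | false | true  = m≤n⇒m≤1+n (count-mono S⊆T xs)
... | false | false = count-mono S⊆T xs

agree-∷ : ∀ {S T : HexSet} {x xs} → T x ≡ S x → (∀ {y} → y ∈ xs → T y ≡ S y) →
  ∀ {y} → y ∈ x ∷ xs → T y ≡ S y
agree-∷ eq _     (here refl)  = eq
agree-∷ _  agree (there y∈xs) = agree y∈xs

agree-or-count< : ∀ {S T} → S ⊆ₕ T → ∀ xs →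
  (∀ {x} → x ∈ xs → T x ≡ S x) ⊎ count S xs < count T xs
agree-or-count< S⊆T [] = inj₁ λ ()
agree-or-count< {S} {T} S⊆T (x ∷ xs)
  with S x in eS | T x in eT | agree-or-count< S⊆T xs
... | true  | false | _        with () ← trans (sym (S⊆T eS)) eT
... | false | true  | _        = inj₂ (s≤s (count-mono S⊆T xs))
... | true  | true  | inj₂ lt  = inj₂ (s≤s lt)
... | false | false | inj₂ lt  = inj₂ lt
... | true  | true  | inj₁ agree = inj₁ (agree-∷ (trans eT (sym eS)) agree)
... | false | false | inj₁ agree = inj₁ (agree-∷ (trans eT (sym eS)) agree)

Stable : (ℕ → HexSet) → ℕ → Set
Stable F k = ∀ x → F (suc k) x ≡ F k x

-- Each step either changes nothing, and then nothing changes ever after, or adds a new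
-- element of xs; so the chain is stable after length xs + 1 steps.
chain-stabilises : (F : ℕ → HexSet) (xs : List Hex) →
  (∀ k → F k ⊆ₕ F (suc k)) → (∀ k {x} → x ∈ₕ F k → x ∈ xs) →
  (∀ k → Stable F k → Stable F (suc k)) → Stable F (suc (length xs))
chain-stabilises F xs increasing bounded stable-suc =
  [ id , (λ large → ⊥-elim (<-irrefl refl (≤-trans large (count≤length _ xs)))) ]′
    (stable-or-large (suc (length xs)))
  where
  agree⇒stable : ∀ k → (∀ {x} → x ∈ xs → F (suc k) x ≡ F k x) → Stable F k
  agree⇒stable k agree x with F (suc k) x in e₁ | F k x in e₀
  ... | true  | _     = trans (sym e₁) (trans (agree (bounded (suc k) e₁)) e₀)
  ... | false | true  with () ← trans (sym (increasing k e₀)) e₁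
  ... | false | false = refl

  stable-or-large : ∀ k → Stable F k ⊎ k ≤ count (F k) xs
  stable-or-large zero = inj₂ z≤n
  stable-or-large (suc k) with agree-or-count< (increasing k) xs | stable-or-large k
  ... | inj₁ agree | _         = inj₁ (stable-suc k (agree⇒stable k agree))
  ... | inj₂ _     | inj₁ st   = inj₁ (stable-suc k st)
  ... | inj₂ grows | inj₂ large = inj₂ (≤-trans (s≤s large) grows)

module Component (S : HexSet) (h : Hex) (h∈S : h ∈ₕ S) (fin : FiniteSet S) where

  ball : ℕ → HexSet
  ball zero    x = ⌊ x ≟ₕ h ⌋ ∧ S x
  ball (suc k) x = ball k x ∨ (S x ∧ adjacentTo (ball k) x)

  ball-walk : ∀ k {x} → x ∈ₕ ball k → Walk S h x
  ball-walk zero {x} x∈ with x ≟ₕ h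
  ... | yes refl = here x∈
  ball-walk (suc k) {x} x∈ with ball k x in e
  ... | true  = ball-walk k e
  ... | false with adjacentTo-sound {ball k} {x} (∧-conicalʳ (S x) _ x∈)
  ...   | y , y∈ , y~x = ball-walk k y∈ ++ʷ step (Walk-end (ball-walk k y∈)) y~x (here x∈S)
    where
    x∈S : x ∈ₕ S
    x∈S = ∧-conicalˡ (S x) _ x∈

  ball-increasing : ∀ k → ball k ⊆ₕ ball (suc k)
  ball-increasing k {x} x∈ = cong (_∨ (S x ∧ adjacentTo (ball k) x)) x∈

  h∈ball : ∀ k → h ∈ₕ ball k
  h∈ball zero with h ≟ₕ h
  ... | yes _   = h∈S
  ... | no h≢h = ⊥-elim (h≢h refl)
  h∈ball (suc k) = ball-increasing k (h∈ball k)

  ball-stable-suc : ∀ k → Stable ball k → Stable ball (suc k)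
  ball-stable-suc k stable x = cong₂ _∨_ (stable x) (cong (S x ∧_) (adjacentTo-cong stable x))

  N : ℕ
  N = suc (length (proj₁ fin))

  ball-stable : Stable ball N
  ball-stable = chain-stabilises ball (proj₁ fin) ball-increasing
    (λ k x∈ → proj₂ fin _ (Walk-end (ball-walk k x∈))) ball-stable-suc

  component : HexSet
  component = ball N

  h∈component : h ∈ₕ component
  h∈component = h∈ball N

  component-⊆ : component ⊆ₕ S
  component-⊆ x∈ = Walk-end (ball-walk N x∈)

  component-closed : ClosedIn component S
  component-closed {x} {y} x∈ x~y y∈S = begin
    ball N y                                 ≡⟨ ball-stable y ⟨
    ball N y ∨ (S y ∧ adjacentTo (ball N) y) ≡⟨ cong (ball N y ∨_) (cong₂ _∧_ y∈S y∈adj) ⟩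
    ball N y ∨ true                          ≡⟨ ∨-zeroʳ _ ⟩
    true                                     ∎
    where
    open ≡-Reasoning
    y∈adj : y ∈ₕ adjacentTo (ball N)
    y∈adj = adjacentTo-complete {ball N} {y} {x} x∈ x~y

  walk-in-component : ∀ {x} → x ∈ₕ component → Walk component h x
  walk-in-component x∈ = Walk-closed component-closed h∈component (ball-walk N x∈)

  component-spec : ∀ x → (x ∈ₕ component) ⇔ (x ∈ₕ S × Walk S h x)
  component-spec x = mk⇔ (λ x∈ → component-⊆ x∈ , ball-walk N x∈)
    (λ (_ , w) → Walk-end (Walk-closed component-closed h∈component w))

  component-connected : Connected component
  component-connected = connected-towards h∈component (Walk-reverse ∘ walk-in-component)

∁-component-connected : ∀ {B₁ B₂ C h o} →
  Connected B₁ → Connected (∁ₕ B₁) → Connected (∁ₕ B₂) → o ∈ₕ ∁ₕ B₁ → o ∈ₕ ∁ₕ B₂ →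
  C ⊆ₕ (B₁ ∩ₕ B₂) → ClosedIn C (B₁ ∩ₕ B₂) → h ∈ₕ C → Connected (∁ₕ C)
∁-component-connected {B₁} {B₂} {C} {h} {o}
  (_ , joined₁) (_ , joined∁₁) (_ , joined∁₂) o∉B₁ o∉B₂ C⊆ closed h∈C =
  connected-towards (∁B₁⊆∁C o∉B₁) towards-o
  where
  ∁B₁⊆∁C : ∁ₕ B₁ ⊆ₕ ∁ₕ C
  ∁B₁⊆∁C = ∁-anti {C} (λ x∈C → ∩-⊆ˡ {B₁} {B₂} (C⊆ x∈C))

  ∁B₂⊆∁C : ∁ₕ B₂ ⊆ₕ ∁ₕ C
  ∁B₂⊆∁C = ∁-anti {C} (λ x∈C → ∩-⊆ʳ {B₁} {B₂} (C⊆ x∈C))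

  escape : ∀ {x} → x ∈ₕ ∁ₕ C → Walk B₁ x h → Walk (∁ₕ C) x o
  escape x∉C (here _) = ⊥-elim (∈∁⇒∉ {C} x∉C h∈C)
  escape {x} x∉C (step {y = y} x∈B₁ x~y w) with B₂ x in e₂ | C y in eC
  ... | false | _     = Walk-mono ∁B₂⊆∁C (joined∁₂ x o (∉⇒∈∁ {B₂} e₂) o∉B₂)
  ... | true  | false = step x∉C x~y (escape (∉⇒∈∁ {C} eC) w)
  ... | true  | true  = ⊥-elim (∈∁⇒∉ {C} x∉C x∈C)
    where
    x∈C : x ∈ₕ C
    x∈C = closed eC (Adj-sym {x} {y} x~y) (∈-∩ {B₁} {B₂} x∈B₁ e₂)

  towards-o : ∀ {x} → x ∈ₕ ∁ₕ C → Walk (∁ₕ C) x o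
  towards-o {x} x∉C with B₁ x in e₁
  ... | false = Walk-mono ∁B₁⊆∁C (joined∁₁ x o (∉⇒∈∁ {B₁} e₁) o∉B₁)
  ... | true  = escape x∉C (joined₁ x h e₁ (∩-⊆ˡ {B₁} {B₂} (C⊆ h∈C)))

lemma2p15 : (B₁ B₂ : HexSet) → IsBenzenoid B₁ → IsBenzenoid B₂ →
    (h : Hex) → h ∈ₕ (B₁ ∩ₕ B₂) →
    ∃ λ (C : HexSet) →
      (∀ x → (x ∈ₕ C) ⇔ (x ∈ₕ (B₁ ∩ₕ B₂) × Joined (B₁ ∩ₕ B₂) h x)) × IsBenzenoid C
lemma2p15 B₁ B₂ (fin₁ , conn₁ , conn∁₁) (fin₂ , _ , conn∁₂) h h∈S =
  component , component-spec , finite , component-connected ,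
  ∁-component-connected conn₁ conn∁₁ conn∁₂ o∉B₁ o∉B₂ component-⊆ component-closed h∈component
  where
  open Component (B₁ ∩ₕ B₂) h h∈S (FiniteSet-⊆ (∩-⊆ˡ {B₁} {B₂}) fin₁)

  finite : FiniteSet component
  finite = FiniteSet-⊆ (λ x∈ → ∩-⊆ˡ {B₁} {B₂} (component-⊆ x∈)) fin₁

  o : Hex
  o = proj₁ (fresh (proj₁ fin₁ ++ proj₁ fin₂))

  o∉xs₁++xs₂ : o ∉ proj₁ fin₁ ++ proj₁ fin₂
  o∉xs₁++xs₂ = proj₂ (fresh (proj₁ fin₁ ++ proj₁ fin₂))

  o∉B₁ : o ∈ₕ ∁ₕ B₁
  o∉B₁ = FiniteSet-∉ fin₁ (o∉xs₁++xs₂ ∘ ∈-++⁺ˡ)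

  o∉B₂ : o ∈ₕ ∁ₕ B₂
  o∉B₂ = FiniteSet-∉ fin₂ (o∉xs₁++xs₂ ∘ ∈-++⁺ʳ (proj₁ fin₁))
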